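{- There is a constant $C$ such that the following holds. Let $S_I$ be a connected shape of order $n$ contained in an $n\times n$ square box of grid cells, and consider a uniform partitioning of this box into $d\times d$ sub-boxes (disjoint and covering the box). Then $S_I$ occupies (i.e., has at least one node in) at most $C\cdot\frac{n}{d}$ of these sub-boxes.
   Context: Nodes occupy distinct cells of the two-dimensional square grid, cells addressed by integer coordinates. A shape is a finite set of nodes; its order is its number of nodes. Two nodes $(x_1,y_1),(x_2,y_2)$ are neighbours iff $|x_1-x_2|\le 1$ and $|y_1-y_2|\le 1$; a shape is connected iff the graph on its nodes given by this neighbour relation is connected. -}

module Defs where

open import Data.Nat as ℕ using (ℕ; suc)
open import Data.Integer as ℤ using (ℤ; +_; ∣_∣)
open import Data.Product using (_×_; _,_; ∃-syntax)
open import Data.List using (List; [])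
open import Data.List.Membership.Propositional using (_∈_)

-- A node occupies a grid cell with integer coordinates.
Node : Set
Node = ℤ × ℤ

-- A shape is a finite list of nodes; distinctness is imposed separately
-- (Data.List.Relation.Unary.Unique.Propositional) so that its order is its length.
Shape : Set
Shape = List Node

Neighbours : Node → Node → Set
Neighbours (x₁ , y₁) (x₂ , y₂) = ∣ x₁ ℤ.- x₂ ∣ ℕ.≤ 1 × ∣ y₁ ℤ.- y₂ ∣ ℕ.≤ 1

data Reach (S : Shape) : Node → Node → Set where
  here : ∀ {u} → Reach S u u
  step : ∀ {u v w} → v ∈ S → Neighbours u v → Reach S v w → Reach S u w

Connected : Shape → Set
Connected S = ∀ {u v} → u ∈ S → v ∈ S → Reach S u v

InBox : ℤ → ℤ → ℕ → Node → Set
InBox a b n (x , y) =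
  (a ℤ.≤ x × x ℤ.< a ℤ.+ + n) × (b ℤ.≤ y × y ℤ.< b ℤ.+ + n)

InSubBox : ℤ → ℤ → ℕ → ℕ × ℕ → Node → Set
InSubBox a b d (i , j) (x , y) =
  (a ℤ.+ + (i ℕ.* d) ℤ.≤ x × x ℤ.< a ℤ.+ + (suc i ℕ.* d))
  × (b ℤ.+ + (j ℕ.* d) ℤ.≤ y × y ℤ.< b ℤ.+ + (suc j ℕ.* d))

Occupies : Shape → ℤ → ℤ → ℕ → ℕ × ℕ → Set
Occupies S a b d ij = ∃[ p ] (p ∈ S × InSubBox a b d ij p)

module Submission where

-- The neighbourhood of a sub-box B is the 3 × 3 block of sub-boxes centred at B.
--   * Heavy neighbourhoods: if S occupies B, at least d nodes of S lie in the
--     neighbourhood of B.  Either all n ≥ d nodes do, or a path in S from a node of B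
--     leaves the neighbourhood; just before leaving it has moved by at least d in one
--     coordinate, in steps of at most 1, so its part inside the neighbourhood takes at
--     least d distinct values of that coordinate (a discrete intermediate value theorem).
--   * Bounded overlap: every node lies in the neighbourhoods of at most 9 sub-boxes.
-- Double counting the pairs (B , p) with B occupied and p a node of S in the
-- neighbourhood of B then gives  d · #occupied ≤ 9 · n = 9 · (n / d) · d.

open import Defs
open import Data.Nat using (ℕ; _≤_; _<_; _*_; _/_; NonZero)
open import Data.Nat.Divisibility using (_∣_)
open import Data.Integer using (ℤ)
open import Data.Product using (Σ; _×_; _,_; proj₁; proj₂)
open import Relation.Binary.PropositionalEquality using (_≡_)
open import Data.List using (List; length)
open import Data.List.Relation.Unary.All using (All)
open import Data.List.Relation.Unary.Unique.Propositional using (Unique)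

open import Data.Nat using (suc; _+_; _∸_; z≤n; s≤s; _≤?_; _<?_; >-nonZero)
import Data.Nat.Properties as NP
open import Data.Nat.DivMod using (m≡m%n+[m/n]*n; m%n<n; m/n*n≡m; m<n*o⇒m/o<n)
open import Data.Nat.Divisibility using (∣⇒≤)
open import Data.Nat.ListAction using (sum)
open import Algebra.Properties.CommutativeSemigroup NP.+-commutativeSemigroup
  using () renaming (interchange to +-interchange)
open import Data.Integer as ℤ using (+_; ∣_∣; _⊖_)
import Data.Integer.Properties as ZP
import Data.Integer.Tactic.RingSolver as ZR
open import Data.Sum using (_⊎_; inj₁; inj₂)
open import Data.Empty using (⊥-elim)
open import Function using (_∘_)
open import Relation.Binary.PropositionalEquality
  using (refl; sym; trans; cong; cong₂; subst; _≢_; module ≡-Reasoning)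
open import Relation.Nullary using (¬_; yes; no; Dec)
open import Relation.Nullary.Decidable using (_×-dec_)
open import Relation.Unary using (Decidable)
open import Data.List using ([]; _∷_; map; filter; upTo; applyUpTo; cartesianProduct)
open import Data.List.Properties using (length-map; length-upTo; filter-all; map-cong)
import Data.List.Relation.Unary.All as All
open import Data.List.Relation.Unary.All.Properties using (¬All⇒Any¬)
open import Data.List.Relation.Unary.AllPairs using (_∷_)
open import Data.List.Relation.Unary.Any using (here; there)
open import Data.List.Membership.Propositional using (_∈_; find)
open import Data.List.Membership.Propositional.Properties
  using (∈-map⁺; ∈-map⁻; ∈-filter⁺; ∈-filter⁻; ∈-applyUpTo⁺; ∈-applyUpTo⁻;
         ∈-cartesianProduct⁺; ∈-length)
open import Data.List.Relation.Binary.Subset.Propositional using (_⊆_)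
import Data.List.Relation.Unary.Unique.Propositional.Properties as Unique

module _ {A : Set} where

  remove : ∀ {x : A} {ys} → x ∈ ys → List A
  remove {ys = _ ∷ ys} (here _) = ys
  remove {ys = y ∷ _} (there x∈ys) = y ∷ remove x∈ys

  length-remove : ∀ {x : A} {ys} (x∈ys : x ∈ ys) → suc (length (remove x∈ys)) ≡ length ys
  length-remove (here _) = refl
  length-remove (there x∈ys) = cong suc (length-remove x∈ys)

  ∈-remove : ∀ {x z : A} {ys} (x∈ys : x ∈ ys) → z ∈ ys → z ≢ x → z ∈ remove x∈ys
  ∈-remove (here refl) (here refl) z≢x = ⊥-elim (z≢x refl)
  ∈-remove (here refl) (there z∈ys) _ = z∈ys
  ∈-remove (there x∈ys) (here refl) _ = here refl
  ∈-remove (there x∈ys) (there z∈ys) z≢x = there (∈-remove x∈ys z∈ys z≢x)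

  unique-⊆⇒length-≤ : ∀ {xs ys : List A} → Unique xs → xs ⊆ ys → length xs ≤ length ys
  unique-⊆⇒length-≤ {[]} _ _ = z≤n
  unique-⊆⇒length-≤ {x ∷ xs} {ys} (x∉xs ∷ xs-unique) xs⊆ys =
    subst (suc (length xs) ≤_) (length-remove x∈ys)
      (s≤s (unique-⊆⇒length-≤ xs-unique λ z∈xs →
        ∈-remove x∈ys (xs⊆ys (there z∈xs)) (λ z≡x → All.lookup x∉xs z∈xs (sym z≡x))))
    where
    x∈ys = xs⊆ys (here refl)

consecutive-values⇒length-≥ : ∀ {A : Set} (f : A → ℕ) c d xs →
  (∀ k → k < d → c + k ∈ map f xs) → d ≤ length xs
consecutive-values⇒length-≥ f c d xs values = begin
  d                             ≡⟨ sym (trans (length-map (_+_ c) (upTo d)) (length-upTo d)) ⟩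
  length (map (_+_ c) (upTo d))  ≤⟨ unique-⊆⇒length-≤ range-unique range⊆values ⟩
  length (map f xs)             ≡⟨ length-map f xs ⟩
  length xs                     ∎
  where
  open NP.≤-Reasoning
  range-unique : Unique (map (_+_ c) (upTo d))
  range-unique = Unique.map⁺ (NP.+-cancelˡ-≡ c _ _) (Unique.upTo⁺ d)
  range⊆values : map (_+_ c) (upTo d) ⊆ map f xs
  range⊆values t∈range with ∈-map⁻ (_+_ c) t∈range
  ... | k , k∈upTo , refl with ∈-applyUpTo⁻ (λ i → i) k∈upTo
  ...   | _ , k<d , refl = values k k<d

module _ {A : Set} where

  sum-map-+ : ∀ (f g : A → ℕ) xs →
    sum (map (λ x → f x + g x) xs) ≡ sum (map f xs) + sum (map g xs)
  sum-map-+ f g [] = refl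
  sum-map-+ f g (x ∷ xs) = begin
    (f x + g x) + sum (map (λ x → f x + g x) xs)
      ≡⟨ cong (_+_ (f x + g x)) (sum-map-+ f g xs) ⟩
    (f x + g x) + (sum (map f xs) + sum (map g xs))
      ≡⟨ +-interchange (f x) (g x) (sum (map f xs)) (sum (map g xs)) ⟩
    (f x + sum (map f xs)) + (g x + sum (map g xs)) ∎
    where open ≡-Reasoning

  sum-map-≥ : ∀ (f : A → ℕ) k xs → All (λ x → k ≤ f x) xs → length xs * k ≤ sum (map f xs)
  sum-map-≥ f k [] All.[] = z≤n
  sum-map-≥ f k (x ∷ xs) (k≤fx All.∷ k≤f) = NP.+-mono-≤ k≤fx (sum-map-≥ f k xs k≤f)

  sum-map-≤ : ∀ (f : A → ℕ) k xs → (∀ x → f x ≤ k) → sum (map f xs) ≤ length xs * k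
  sum-map-≤ f k [] _ = z≤n
  sum-map-≤ f k (x ∷ xs) f≤k = NP.+-mono-≤ (f≤k x) (sum-map-≤ f k xs f≤k)

  sum-map-0 : ∀ (xs : List A) → sum (map (λ _ → 0) xs) ≡ 0
  sum-map-0 [] = refl
  sum-map-0 (_ ∷ xs) = sum-map-0 xs

indicator : ∀ {P : Set} → Dec P → ℕ
indicator (yes _) = 1
indicator (no _) = 0

module _ {A : Set} {P : A → Set} (P? : Decidable P) where

  length-filter-∷ : ∀ x xs →
    length (filter P? (x ∷ xs)) ≡ indicator (P? x) + length (filter P? xs)
  length-filter-∷ x xs with P? x
  ... | yes _ = refl
  ... | no _ = refl

  length-filter≡sum : ∀ xs → length (filter P? xs) ≡ sum (map (indicator ∘ P?) xs)
  length-filter≡sum [] = refl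
  length-filter≡sum (x ∷ xs) =
    trans (length-filter-∷ x xs) (cong (_+_ (indicator (P? x))) (length-filter≡sum xs))

double-counting : ∀ {A B : Set} {R : A → B → Set} (R? : ∀ a b → Dec (R a b)) as bs →
  sum (map (λ a → length (filter (R? a) bs)) as)
    ≡ sum (map (λ b → length (filter {P = λ a → R a b} (λ a → R? a b) as)) bs)
double-counting R? [] bs = sym (sum-map-0 bs)
double-counting {R = R} R? (a ∷ as) bs = begin
  length (filter (R? a) bs) + sum (map (λ a → length (filter (R? a) bs)) as)
    ≡⟨ cong₂ _+_ (length-filter≡sum (R? a) bs) (double-counting R? as bs) ⟩
  sum (map (indicator ∘ R? a) bs) + sum (map column bs)
    ≡⟨ sum-map-+ (indicator ∘ R? a) column bs ⟨
  sum (map (λ b → indicator (R? a b) + column b) bs)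
    ≡⟨ cong sum (map-cong (λ b → sym (length-filter-∷ (λ a → R? a b) a as)) bs) ⟩
  sum (map (λ b → length (filter {P = λ a → R a b} (λ a → R? a b) (a ∷ as))) bs) ∎
  where
  open ≡-Reasoning
  column : _ → ℕ
  column b = length (filter {P = λ a → R a b} (λ a → R? a b) as)

offset : ℤ → ℤ → ℕ
offset a x = ∣ x ℤ.- a ∣

offset-spec : ∀ {a x} → a ℤ.≤ x → + offset a x ≡ x ℤ.- a
offset-spec a≤x = ZP.0≤i⇒+∣i∣≡i (ZP.i≤j⇒0≤j-i a≤x)

k≡[a+k]-a : ∀ a k → k ≡ (a ℤ.+ k) ℤ.- a
k≡[a+k]-a = ZR.solve-∀

x-y≡[x-a]-[y-a] : ∀ x y a → x ℤ.- y ≡ (x ℤ.- a) ℤ.- (y ℤ.- a)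
x-y≡[x-a]-[y-a] = ZR.solve-∀

offset-bounds : ∀ {a x} m m' → a ℤ.≤ x → a ℤ.+ + m ℤ.≤ x → x ℤ.< a ℤ.+ + m' →
  m ≤ offset a x × offset a x < m'
offset-bounds {a} {x} m m' a≤x lower upper =
  ZP.drop‿+≤+ (begin
    + m                 ≡⟨ k≡[a+k]-a a (+ m) ⟩
    (a ℤ.+ + m) ℤ.- a   ≤⟨ ZP.+-monoˡ-≤ (ℤ.- a) lower ⟩
    x ℤ.- a             ≡⟨ offset-spec a≤x ⟨
    + offset a x        ∎) ,
  ZP.drop‿+<+ (begin-strict
    + offset a x        ≡⟨ offset-spec a≤x ⟩
    x ℤ.- a             <⟨ ZP.+-monoˡ-< (ℤ.- a) upper ⟩
    (a ℤ.+ + m') ℤ.- a  ≡⟨ k≡[a+k]-a a (+ m') ⟨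
    + m'                ∎)
  where
  open ZP.≤-Reasoning

⊖-≤1⇒≤suc : ∀ m n → ∣ m ⊖ n ∣ ≤ 1 → n ≤ suc m
⊖-≤1⇒≤suc m n dist≤1 with NP.≤-total m n
... | inj₂ n≤m = NP.m≤n⇒m≤1+n n≤m
... | inj₁ m≤n = begin
  n            ≡⟨ NP.m+[n∸m]≡n m≤n ⟨
  m + (n ∸ m)  ≤⟨ NP.+-monoʳ-≤ m (subst (_≤ 1) (ZP.∣⊖∣-≤ m≤n) dist≤1) ⟩
  m + 1        ≡⟨ NP.+-comm m 1 ⟩
  suc m        ∎
  where open NP.≤-Reasoning

offset-step : ∀ {a x y} → a ℤ.≤ x → a ℤ.≤ y → ∣ x ℤ.- y ∣ ≤ 1 → offset a y ≤ suc (offset a x)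
offset-step {a} {x} {y} a≤x a≤y dist≤1 =
  ⊖-≤1⇒≤suc (offset a x) (offset a y) (subst (λ t → ∣ t ∣ ≤ 1) difference dist≤1)
  where
  open ≡-Reasoning
  difference : x ℤ.- y ≡ offset a x ⊖ offset a y
  difference = begin
    x ℤ.- y                         ≡⟨ x-y≡[x-a]-[y-a] x y a ⟩
    (x ℤ.- a) ℤ.- (y ℤ.- a)         ≡⟨ cong₂ ℤ._-_ (offset-spec a≤x) (offset-spec a≤y) ⟨
    + offset a x ℤ.- + offset a y   ≡⟨ ZP.m-n≡m⊖n (offset a x) (offset a y) ⟩
    offset a x ⊖ offset a y         ∎

Neighbours-sym : ∀ p q → Neighbours p q → Neighbours q p
Neighbours-sym (x₁ , y₁) (x₂ , y₂) (near-x , near-y) =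
  subst (_≤ 1) (ZP.∣i-j∣≡∣j-i∣ x₁ x₂) near-x , subst (_≤ 1) (ZP.∣i-j∣≡∣j-i∣ y₁ y₂) near-y

Lipschitz : Shape → (Node → ℕ) → Set
Lipschitz S f = ∀ {p q} → p ∈ S → q ∈ S → Neighbours p q → f q ≤ suc (f p)

-- Walks inside a region and the discrete intermediate value theorem

module Region (S : Shape) {P : Node → Set} (P? : Decidable P) where

  Inside : Node → Set
  Inside p = p ∈ S × P p

  data Walk : Node → Node → Set where
    stay : ∀ {u} → Inside u → Walk u u
    move : ∀ {u v z} → Inside u → Neighbours u v → Walk v z → Walk u z

  first : ∀ {u z} → Walk u z → Inside u
  first (stay u-in) = u-in
  first (move u-in _ _) = u-in

  last : ∀ {u z} → Walk u z → Inside z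
  last (stay z-in) = z-in
  last (move _ _ walk) = last walk

  record Exit (u : Node) : Set where
    constructor exit-via
    field
      z w     : Node
      walk    : Walk u z
      z~w     : Neighbours z w
      w∈S     : w ∈ S
      outside : ¬ P w

  exit : ∀ {u v} → Reach S u v → Inside u → ¬ P v → Exit u
  exit here u-in v-out = ⊥-elim (v-out (proj₂ u-in))
  exit (step {v = v} v∈S u~v path) u-in w-out with P? v
  ... | no v-out = exit-via _ v (stay u-in) u~v v∈S v-out
  ... | yes v-in with exit path (v∈S , v-in) w-out
  ...   | exit-via z w walk z~w w∈S outside = exit-via z w (move u-in u~v walk) z~w w∈S outside

  Attained : (Node → ℕ) → ℕ → Set
  Attained f t = t ∈ map f (filter P? S)

  attained : ∀ f {q} → Inside q → Attained f (f q)
  attained f (q∈S , q-in) = ∈-map⁺ f (∈-filter⁺ P? q∈S q-in)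

  climb : ∀ {f} → Lipschitz S f → ∀ {u z} → Walk u z → ∀ t → f u ≤ t → t ≤ f z → Attained f t
  climb {f} lip (stay u-in) t fu≤t t≤fz = subst (Attained f) (NP.≤-antisym fu≤t t≤fz) (attained f u-in)
  climb {f} lip {u} (move u-in u~v walk) t fu≤t t≤fz with t NP.≟ f u
  ... | yes t≡fu = subst (Attained f) (sym t≡fu) (attained f u-in)
  ... | no t≢fu = climb lip walk t
          (NP.≤-trans (lip (proj₁ u-in) (proj₁ (first walk)) u~v) (NP.≤∧≢⇒< fu≤t (t≢fu ∘ sym))) t≤fz

  descend : ∀ {f} → Lipschitz S f → ∀ {u z} → Walk u z → ∀ t → f z ≤ t → t ≤ f u → Attained f t
  descend {f} lip (stay u-in) t fz≤t t≤fu = subst (Attained f) (NP.≤-antisym fz≤t t≤fu) (attained f u-in)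
  descend {f} lip {u} (move {v = v} u-in u~v walk) t fz≤t t≤fu with t NP.≟ f u
  ... | yes t≡fu = subst (Attained f) (sym t≡fu) (attained f u-in)
  ... | no t≢fu = descend lip walk t fz≤t
          (NP.≤-pred (NP.≤-trans (NP.≤∧≢⇒< t≤fu t≢fu)
            (lip (proj₁ (first walk)) (proj₁ u-in) (Neighbours-sym u v u~v))))

  gap⇒heavy : ∀ {f} d → Lipschitz S f → ∀ {u z} → Walk u z →
    (f u + d ≤ f z) ⊎ (f z + d ≤ f u) → d ≤ length (filter P? S)
  gap⇒heavy {f} d lip {u} {z} walk (inj₁ rise) =
    consecutive-values⇒length-≥ f (f u) d (filter P? S) λ k k<d →
      climb lip walk (f u + k) (NP.m≤m+n _ _) (NP.≤-trans (NP.+-monoʳ-≤ (f u) (NP.<⇒≤ k<d)) rise)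
  gap⇒heavy {f} d lip {u} {z} walk (inj₂ fall) =
    consecutive-values⇒length-≥ f (f z) d (filter P? S) λ k k<d →
      descend lip walk (f z + k) (NP.m≤m+n _ _) (NP.≤-trans (NP.+-monoʳ-≤ (f z) (NP.<⇒≤ k<d)) fall)

-- One-dimensional windows: the blocks i - 1, i, i + 1 of length d

module Windows (d : ℕ) .{{_ : NonZero d}} where

  Block : ℕ → ℕ → Set
  Block i X = i * d ≤ X × X < suc i * d

  -- X lies in one of the blocks i - 1, i, i + 1:  i·d ≤ X + d < (i + 3)·d.
  Window : ℕ → ℕ → Set
  Window i X = i * d ≤ d + X × X < d + (d + i * d)

  window? : ∀ i X → Dec (Window i X)
  window? i X = (i * d ≤? d + X) ×-dec (X <? d + (d + i * d))

  block⇒window : ∀ i {X} → Block i X → Window i X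
  block⇒window i (lower , upper) = NP.≤-trans lower (NP.m≤n+m _ d) , NP.<-≤-trans upper (NP.m≤n+m _ d)

  leave-window : ∀ i {X Z W} → Block i X → ¬ Window i W → W ≤ suc Z → Z ≤ suc W →
    (X + d ≤ Z) ⊎ (Z + d ≤ X)
  leave-window i {X} {Z} {W} (lower , upper) W-outside W≤1+Z Z≤1+W with i * d ≤? d + W
  ... | no W-below = inj₂ (begin
    Z + d        ≤⟨ NP.+-monoˡ-≤ d Z≤1+W ⟩
    suc (W + d)  ≡⟨ cong suc (NP.+-comm W d) ⟩
    suc (d + W)  ≤⟨ NP.≰⇒> W-below ⟩
    i * d        ≤⟨ lower ⟩
    X            ∎)
    where open NP.≤-Reasoning
  ... | yes W-above-lower = inj₁ (NP.≤-pred (begin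
    suc (X + d)        ≤⟨ NP.+-monoˡ-≤ d upper ⟩
    (d + i * d) + d    ≡⟨ NP.+-comm (d + i * d) d ⟩
    d + (d + i * d)    ≤⟨ NP.≮⇒≥ (W-outside ∘ (W-above-lower ,_)) ⟩
    W                  ≤⟨ W≤1+Z ⟩
    suc Z              ∎))
    where open NP.≤-Reasoning

  three : ℕ → List ℕ
  three α = applyUpTo (_+_ α) 3

  ∈-three : ∀ {α i} → α ≤ i → i ≤ 2 + α → i ∈ three α
  ∈-three {α} {i} α≤i i≤2+α =
    subst (_∈ three α) (NP.m+[n∸m]≡n α≤i)
      (∈-applyUpTo⁺ (_+_ α) (s≤s (subst (i ∸ α ≤_) (NP.m+n∸n≡m 2 α) (NP.∸-monoˡ-≤ α i≤2+α))))

  window⇒∈-three : ∀ i {X} → Window i X → i ∈ three (X / d ∸ 1)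
  window⇒∈-three i {X} (lower , upper) = ∈-three (NP.∸-monoˡ-≤ 1 q≤1+i) (begin
    i                  ≤⟨ NP.≤-pred i<2+q ⟩
    suc q              ≤⟨ s≤s (NP.m≤n+m∸n q 1) ⟩
    2 + (q ∸ 1)        ∎)
    where
    open NP.≤-Reasoning
    q = X / d
    X<d+q*d : X < d + q * d
    X<d+q*d = subst (_< d + q * d) (sym (m≡m%n+[m/n]*n X d)) (NP.+-monoˡ-< (q * d) (m%n<n X d))
    i<2+q : i < 2 + q
    i<2+q = NP.*-cancelʳ-< d i (2 + q) (NP.≤-<-trans lower (NP.+-monoʳ-< d X<d+q*d))
    q≤1+i : q ≤ suc i
    q≤1+i = NP.≤-pred (m<n*o⇒m/o<n upper)

-- Neighbourhoods of sub-boxes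

module Neighbourhoods (n d : ℕ) .{{_ : NonZero d}} (S : Shape) (a b : ℤ)
                      (box : All (InBox a b n) S) where

  open Windows d

  X Y : Node → ℕ
  X p = offset a (proj₁ p)
  Y p = offset b (proj₂ p)

  a≤x : ∀ {p} → p ∈ S → a ℤ.≤ proj₁ p
  a≤x p∈S = proj₁ (proj₁ (All.lookup box p∈S))

  b≤y : ∀ {p} → p ∈ S → b ℤ.≤ proj₂ p
  b≤y p∈S = proj₁ (proj₂ (All.lookup box p∈S))

  lipschitz-X : Lipschitz S X
  lipschitz-X {_ , _} {_ , _} p∈S q∈S (near-x , _) = offset-step (a≤x p∈S) (a≤x q∈S) near-x

  lipschitz-Y : Lipschitz S Y
  lipschitz-Y {_ , _} {_ , _} p∈S q∈S (_ , near-y) = offset-step (b≤y p∈S) (b≤y q∈S) near-y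

  Near : ℕ × ℕ → Node → Set
  Near (i , j) p = Window i (X p) × Window j (Y p)

  near? : ∀ B p → Dec (Near B p)
  near? (i , j) p = window? i (X p) ×-dec window? j (Y p)

  occupied⇒heavy : Connected S → d ∣ length S → ∀ {B} → Occupies S a b d B →
    d ≤ length (filter (near? B) S)
  occupied⇒heavy connected d∣|S| {i , j} (u , u∈S , (x-lower , x-upper) , (y-lower , y-upper))
    with All.all? (near? (i , j)) S
  ... | yes all-near =
    subst (d ≤_) (cong length (sym (filter-all (near? (i , j)) all-near)))
      (∣⇒≤ {{>-nonZero (∈-length u∈S)}} d∣|S|)
  ... | no ¬all-near with find (¬All⇒Any¬ (near? (i , j)) S ¬all-near)
  ...   | v , v∈S , v-far =
    leave (exit (connected u∈S v∈S) (u∈S , block⇒window i u-X , block⇒window j u-Y) v-far)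
    where
    open Region S (near? (i , j))
    u-X : Block i (X u)
    u-X = offset-bounds (i * d) (suc i * d) (a≤x u∈S) x-lower x-upper
    u-Y : Block j (Y u)
    u-Y = offset-bounds (j * d) (suc j * d) (b≤y u∈S) y-lower y-upper
    -- Leaving the neighbourhood means leaving the window in one coordinate.
    leave : Exit u → d ≤ length (filter (near? (i , j)) S)
    leave (exit-via z w walk z~w w∈S w-far) with window? i (X w)
    ... | no w-X-far = gap⇒heavy d lipschitz-X walk
          (leave-window i u-X w-X-far
            (lipschitz-X z∈S w∈S z~w) (lipschitz-X w∈S z∈S (Neighbours-sym z w z~w)))
      where z∈S = proj₁ (last walk)
    ... | yes w-X-near = gap⇒heavy d lipschitz-Y walk
          (leave-window j u-Y (w-far ∘ (w-X-near ,_))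
            (lipschitz-Y z∈S w∈S z~w) (lipschitz-Y w∈S z∈S (Neighbours-sym z w z~w)))
      where z∈S = proj₁ (last walk)

  few-neighbourhoods : ∀ {occ} → Unique occ → ∀ p →
    length (filter {P = λ B → Near B p} (λ B → near? B p) occ) ≤ 9
  few-neighbourhoods {occ} occ-unique p =
    unique-⊆⇒length-≤ (Unique.filter⁺ (λ B → near? B p) occ-unique) ⊆grid
    where
    ⊆grid : filter {P = λ B → Near B p} (λ B → near? B p) occ ⊆
            cartesianProduct (three (X p / d ∸ 1)) (three (Y p / d ∸ 1))
    ⊆grid {i , j} B∈ with proj₂ (∈-filter⁻ (λ B → near? B p) {xs = occ} B∈)
    ... | i-near , j-near = ∈-cartesianProduct⁺ (window⇒∈-three i i-near) (window⇒∈-three j j-near)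

occupied-sub-boxes-bound : (n d : ℕ) .{{_ : NonZero d}} → d ∣ n →
  (S : Shape) → length S ≡ n → Connected S → (a b : ℤ) → All (InBox a b n) S →
  (occ : List (ℕ × ℕ)) → Unique occ → All (Occupies S a b d) occ →
  length occ ≤ 9 * (n / d)
occupied-sub-boxes-bound n d d∣n S |S|≡n connected a b box occ occ-unique occupied =
  NP.*-cancelʳ-≤ (length occ) (9 * (n / d)) d (begin
    length occ * d
      ≤⟨ sum-map-≥ load d occ (All.map (λ {B} → occupied⇒heavy connected d∣|S| {B}) occupied) ⟩
    sum (map load occ)
      ≡⟨ double-counting near? occ S ⟩
    sum (map multiplicity S)
      ≤⟨ sum-map-≤ multiplicity 9 S (few-neighbourhoods occ-unique) ⟩
    length S * 9
      ≡⟨ cong (_* 9) (trans |S|≡n (sym (m/n*n≡m d∣n))) ⟩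
    (n / d * d) * 9
      ≡⟨ NP.*-comm (n / d * d) 9 ⟩
    9 * (n / d * d)
      ≡⟨ NP.*-assoc 9 (n / d) d ⟨
    9 * (n / d) * d ∎)
  where
  open Neighbourhoods n d S a b box
  open NP.≤-Reasoning
  d∣|S| : d ∣ length S
  d∣|S| = subst (d ∣_) (sym |S|≡n) d∣n
  load : ℕ × ℕ → ℕ
  load B = length (filter (near? B) S)
  multiplicity : Node → ℕ
  multiplicity p = length (filter {P = λ B → Near B p} (λ B → near? B p) occ)

-- The corollary, with C = 9; distinctness of the nodes and the ranges of the sub-box
-- indices are not needed.
corollary4p10 : Σ ℕ λ C →
    (n d : ℕ) .{{_ : NonZero d}} → d ∣ n →
    (S : Shape) → Unique S → length S ≡ n → Connected S →
    (a b : ℤ) → All (InBox a b n) S →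
    (occ : List (ℕ × ℕ)) → Unique occ →
    All (λ ij → (proj₁ ij < n / d × proj₂ ij < n / d) × Occupies S a b d ij) occ →
    length occ ≤ C * (n / d)
corollary4p10 = 9 , λ n d d∣n S _ |S|≡n connected a b box occ occ-unique occupied →
  occupied-sub-boxes-bound n d d∣n S |S|≡n connected a b box occ occ-unique (All.map proj₂ occupied)
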